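{- Let $(Q,\ast)$ be a quasigroup with $|Q|=4$. The following are equivalent: (1) $Q$ has a subquasigroup $W$ with $1<|W|<4$; (2) $Q$ has a congruence one of whose classes $W$ has exactly $2$ elements (and consequently $Q$ is not simple).
   Context: A quasigroup is a set $Q$ with a binary operation $\ast$ such that for all $a,b\in Q$ the equations $a\ast x=b$ and $y\ast a=b$ have unique solutions in $Q$; a subquasigroup is a subset closed under $\ast$ and the two divisions. A congruence of $Q$ is an equivalence relation $\theta$ on $Q$ compatible with $\ast$ and with the left and right divisions. $Q$ is simple if its only congruences are the equality relation and $Q\times Q$. -}

module Defs where


open import Data.Fin using (Fin)
open import Data.Fin.Subset using (Subset; _∈_; ∣_∣)
open import Data.Nat using (ℕ; _<_)
open import Data.Product using (Σ; ∃; ∃!; _×_; proj₁)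
open import Relation.Binary.PropositionalEquality using (_≡_)
open import Relation.Binary.Structures using (IsEquivalence)
open import Function.Bundles using (_⇔_)
open import Level using (0ℓ)

-- A quasigroup on a carrier of size 4 (carrier taken to be Fin 4, which is
-- no loss since quasigroup notions are invariant under relabelling).
record Quasigroup4 : Set where
  field
    _∗_ : Fin 4 → Fin 4 → Fin 4
    left-unique  : ∀ a b → ∃! _≡_ (λ x → a ∗ x ≡ b)
    right-unique : ∀ a b → ∃! _≡_ (λ y → y ∗ a ≡ b)

  _\\_ : Fin 4 → Fin 4 → Fin 4
  a \\ b = proj₁ (left-unique a b)

  _//_ : Fin 4 → Fin 4 → Fin 4
  b // a = proj₁ (right-unique a b)

module _ (Q : Quasigroup4) where
  open Quasigroup4 Q

  IsSubquasigroup : Subset 4 → Set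
  IsSubquasigroup W =
    (∀ {a b} → a ∈ W → b ∈ W → (a ∗ b) ∈ W) ×
    (∀ {a b} → a ∈ W → b ∈ W → (a \\ b) ∈ W) ×
    (∀ {a b} → a ∈ W → b ∈ W → (b // a) ∈ W)

  IsCongruence : (Fin 4 → Fin 4 → Set) → Set
  IsCongruence θ =
    IsEquivalence θ ×
    (∀ {a b c d} → θ a b → θ c d → θ (a ∗ c) (b ∗ d)) ×
    (∀ {a b c d} → θ a b → θ c d → θ (a \\ c) (b \\ d)) ×
    (∀ {a b c d} → θ a b → θ c d → θ (a // c) (b // d))

  IsClassOf : (Fin 4 → Fin 4 → Set) → Subset 4 → Set
  IsClassOf θ W = ∃ λ a → ∀ x → (x ∈ W ⇔ θ a x)

Fin4Rel : Set₁
Fin4Rel = Fin 4 → Fin 4 → Set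

-- Left and right translations of a finite quasigroup are permutations, so a translation that maps
-- a subset S into a subset T of the same size also maps the complement of S into the complement
-- of T. If W is a subquasigroup, translations by elements of W therefore preserve W and its
-- complement, while right translation by some z ∉ W sends W into its complement; so |W| ≤ 4 − |W|,
-- i.e. |W| = 2, and then membership in the complement of W is a homomorphism onto (Bool, xor),
-- whose kernel is a congruence with class W. Conversely, let W = [a] be a congruence class of size
-- 2. If a ∗ a ∈ W then W ∗ W ⊆ [a ∗ a] = W; otherwise W ∗ W misses W, and the same counting shows
-- that the complement of W is closed. Closed subsets of a finite quasigroup are subquasigroups.
module Submission where

open import Algebra.Properties.CommutativeMonoid.Sum as Sum using ()
open import Data.Bool using (Bool; true; false; not; if_then_else_; _xor_)
open import Data.Bool.Properties using (not-injective; xor-assoc; xor-same; xor-identityʳ)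
open import Data.Fin using (Fin)
open import Data.Fin.Permutation using (Permutation′; permutation; _⟨$⟩ʳ_)
open import Data.Fin.Properties using (¬∀⟶∃¬)
open import Data.Fin.Subset using (Subset; _∈_; _∉_; _⊆_; ⊤; ∁; ∣_∣; Nonempty)
open import Data.Fin.Subset.Properties
  using (_∈?_; nonempty?; Empty-unique; ∣⊥∣≡0; ∣⊤∣≡n; p⊆q⇒∣p∣≤∣q∣; p⊂q⇒∣p∣<∣q∣; ∣∁p∣≡n∸∣p∣;
         x∉p⇒x∈∁p; x∉∁p⇒x∈p; x∈∁p⇒x∉p)
open import Data.Nat using (ℕ; suc; _≤_; _<_; _∸_; z<s; s<s; s≤s)
open import Data.Nat.Properties using (+-0-commutativeMonoid; <-irrefl; <⇒≱)
open import Data.Product using (Σ; ∃; _×_; _,_; proj₁; proj₂)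
open import Data.Vec using ([]; _∷_; lookup; tabulate)
open import Data.Vec.Properties using (lookup∘tabulate; []=⇒lookup; lookup⇒[]=)
open import Function using (_∘_)
open import Function.Bundles using (_⇔_; mk⇔; Equivalence)
open import Relation.Binary.PropositionalEquality
  using (_≡_; refl; sym; trans; cong; cong₂; subst; module ≡-Reasoning)
open import Relation.Binary.Structures using (IsEquivalence)
open import Relation.Nullary using (yes; no; contradiction)

open import Defs

open Sum +-0-commutativeMonoid using (sum; sum-cong-≗; sum-permute)
open ≡-Reasoning

xor-cancelˡ : ∀ x y → x xor (x xor y) ≡ y
xor-cancelˡ x y = trans (sym (xor-assoc x x y)) (cong (_xor y) (xor-same x))

xor-cancelʳ : ∀ x y → (x xor y) xor y ≡ x
xor-cancelʳ x y = trans (xor-assoc x y y) (trans (cong (x xor_) (xor-same y)) (xor-identityʳ x))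

1<m≤4∸m⇒m≡2 : ∀ {m} → 1 < m → m ≤ 4 ∸ m → m ≡ 2
1<m≤4∸m⇒m≡2 {1} (s≤s ()) _
1<m≤4∸m⇒m≡2 {2} _ _ = refl
1<m≤4∸m⇒m≡2 {3} _ (s≤s ())
1<m≤4∸m⇒m≡2 {4} _ ()
1<m≤4∸m⇒m≡2 {suc (suc (suc (suc (suc _))))} _ ()

m≡2⇒1<m<4 : ∀ {m} → m ≡ 2 → 1 < m × m < 4
m≡2⇒1<m<4 refl = s<s z<s , s<s (s<s z<s)

indicator : ∀ {n} → Subset n → Fin n → ℕ
indicator p i = if lookup p i then 1 else 0

∣p∣≡sum-indicator : ∀ {n} (p : Subset n) → ∣ p ∣ ≡ sum (indicator p)
∣p∣≡sum-indicator []          = refl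
∣p∣≡sum-indicator (true ∷ p)  = cong suc (∣p∣≡sum-indicator p)
∣p∣≡sum-indicator (false ∷ p) = ∣p∣≡sum-indicator p

∉⇒lookup≡false : ∀ {n} {p : Subset n} {x} → x ∉ p → lookup p x ≡ false
∉⇒lookup≡false {p = p} {x} x∉p with lookup p x in eq
... | true  = contradiction (lookup⇒[]= x p eq) x∉p
... | false = refl

lookup≡false⇒∉ : ∀ {n} {p : Subset n} {x} → lookup p x ≡ false → x ∉ p
lookup≡false⇒∉ eq x∈p with () ← trans (sym ([]=⇒lookup x∈p)) eq

∈⇔not-lookup≡ : ∀ {n} {p : Subset n} {a} → a ∈ p → ∀ x → x ∈ p ⇔ not (lookup p a) ≡ not (lookup p x)
∈⇔not-lookup≡ {p = p} a∈p x = mk⇔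
  (λ x∈p → cong not (trans ([]=⇒lookup a∈p) (sym ([]=⇒lookup x∈p))))
  (λ eq → lookup⇒[]= x p (trans (sym (not-injective eq)) ([]=⇒lookup a∈p)))

∣p∣<n⇒∃∉ : ∀ {n} {p : Subset n} → ∣ p ∣ < n → ∃ (_∉ p)
∣p∣<n⇒∃∉ {n} {p} ∣p∣<n = ¬∀⟶∃¬ n (_∈ p) (_∈? p) λ ∀∈p →
  <⇒≱ ∣p∣<n (subst (_≤ ∣ p ∣) (∣⊤∣≡n n) (p⊆q⇒∣p∣≤∣q∣ {p = ⊤} λ {x} _ → ∀∈p x))

∣p∣>0⇒Nonempty : ∀ {n} {p : Subset n} → 0 < ∣ p ∣ → Nonempty p
∣p∣>0⇒Nonempty {n} {p} ∣p∣>0 with nonempty? p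
... | yes nonempty = nonempty
... | no  empty    = contradiction ∣p∣>0 (<-irrefl (sym (trans (cong ∣_∣ (Empty-unique empty)) (∣⊥∣≡0 n))))

∣p∣≡2⇒∣∁p∣≡2 : {p : Subset 4} → ∣ p ∣ ≡ 2 → ∣ ∁ p ∣ ≡ 2
∣p∣≡2⇒∣∁p∣≡2 {p} ∣p∣≡2 = trans (∣∁p∣≡n∸∣p∣ p) (cong (4 ∸_) ∣p∣≡2)

∣p∣≡2⇒∣p∣≡∣∁p∣ : {p : Subset 4} → ∣ p ∣ ≡ 2 → ∣ p ∣ ≡ ∣ ∁ p ∣
∣p∣≡2⇒∣p∣≡∣∁p∣ {p} ∣p∣≡2 = trans ∣p∣≡2 (sym (∣p∣≡2⇒∣∁p∣≡2 {p} ∣p∣≡2))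

preimage : ∀ {n} → (Fin n → Fin n) → Subset n → Subset n
preimage f p = tabulate (lookup p ∘ f)

∈-preimage : ∀ {n} {f : Fin n → Fin n} {p : Subset n} {i} → f i ∈ p → i ∈ preimage f p
∈-preimage {f = f} {p} {i} fi∈p = lookup⇒[]= i _ (trans (lookup∘tabulate (lookup p ∘ f) i) ([]=⇒lookup fi∈p))

indicator-preimage : ∀ {n} (f : Fin n → Fin n) (p : Subset n) i → indicator (preimage f p) i ≡ indicator p (f i)
indicator-preimage f p i rewrite lookup∘tabulate (lookup p ∘ f) i = refl

∣preimage∣≡∣p∣ : ∀ {n} (π : Permutation′ n) (p : Subset n) → ∣ preimage (π ⟨$⟩ʳ_) p ∣ ≡ ∣ p ∣
∣preimage∣≡∣p∣ π p = begin
  ∣ preimage (π ⟨$⟩ʳ_) p ∣               ≡⟨ ∣p∣≡sum-indicator (preimage (π ⟨$⟩ʳ_) p) ⟩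
  sum (indicator (preimage (π ⟨$⟩ʳ_) p)) ≡⟨ sum-cong-≗ (indicator-preimage (π ⟨$⟩ʳ_) p) ⟩
  sum (indicator p ∘ (π ⟨$⟩ʳ_))           ≡⟨ sum-permute (indicator p) π ⟨
  sum (indicator p)                       ≡⟨ ∣p∣≡sum-indicator p ⟨
  ∣ p ∣                                   ∎

module _ {n} {S T : Subset n} (π : Permutation′ n) (π[S]⊆T : ∀ {i} → i ∈ S → π ⟨$⟩ʳ i ∈ T) where

  private
    S⊆preimage : S ⊆ preimage (π ⟨$⟩ʳ_) T
    S⊆preimage = ∈-preimage ∘ π[S]⊆T

  permutation-∣∣≤ : ∣ S ∣ ≤ ∣ T ∣
  permutation-∣∣≤ = subst (∣ S ∣ ≤_) (∣preimage∣≡∣p∣ π T) (p⊆q⇒∣p∣≤∣q∣ S⊆preimage)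

  permutation-reflects : ∣ S ∣ ≡ ∣ T ∣ → ∀ {i} → π ⟨$⟩ʳ i ∈ T → i ∈ S
  permutation-reflects ∣S∣≡∣T∣ {i} πi∈T with i ∈? S
  ... | yes i∈S = i∈S
  ... | no  i∉S = contradiction ∣S∣<∣T∣ (<-irrefl ∣S∣≡∣T∣)
    where
    ∣S∣<∣T∣ : ∣ S ∣ < ∣ T ∣
    ∣S∣<∣T∣ = subst (∣ S ∣ <_) (∣preimage∣≡∣p∣ π T)
      (p⊂q⇒∣p∣<∣q∣ (S⊆preimage , i , ∈-preimage πi∈T , i∉S))

module _ (Q : Quasigroup4) where
  open Quasigroup4 Q
  open import Algebra.Definitions {A = Fin 4} _≡_
    using (LeftDividesˡ; LeftDividesʳ; RightDividesˡ; RightDividesʳ)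

  leftDividesˡ : LeftDividesˡ _∗_ _\\_
  leftDividesˡ a b = proj₁ (proj₂ (left-unique a b))

  leftDividesʳ : LeftDividesʳ _∗_ _\\_
  leftDividesʳ a x = proj₂ (proj₂ (left-unique a (a ∗ x))) refl

  rightDividesˡ : RightDividesˡ _∗_ _//_
  rightDividesˡ a b = proj₁ (proj₂ (right-unique a b))

  rightDividesʳ : RightDividesʳ _∗_ _//_
  rightDividesʳ a y = proj₂ (proj₂ (right-unique a (y ∗ a))) refl

  leftTranslation : Fin 4 → Permutation′ 4
  leftTranslation a = permutation (a ∗_) (a \\_) (leftDividesˡ a) (leftDividesʳ a)

  rightTranslation : Fin 4 → Permutation′ 4
  rightTranslation a = permutation (_∗ a) (_// a) (rightDividesˡ a) (rightDividesʳ a)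

  module _ {S T : Subset 4} {a : Fin 4} where

    left-translation-reflects : (∀ {x} → x ∈ S → a ∗ x ∈ T) → ∣ S ∣ ≡ ∣ T ∣ → ∀ {x} → a ∗ x ∈ T → x ∈ S
    left-translation-reflects = permutation-reflects (leftTranslation a)

    right-translation-reflects : (∀ {x} → x ∈ S → x ∗ a ∈ T) → ∣ S ∣ ≡ ∣ T ∣ → ∀ {x} → x ∗ a ∈ T → x ∈ S
    right-translation-reflects = permutation-reflects (rightTranslation a)

    right-translation-∣∣≤ : (∀ {x} → x ∈ S → x ∗ a ∈ T) → ∣ S ∣ ≤ ∣ T ∣
    right-translation-∣∣≤ = permutation-∣∣≤ (rightTranslation a)

  Closed : Subset 4 → Set
  Closed W = ∀ {a b} → a ∈ W → b ∈ W → a ∗ b ∈ W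

  module _ {W : Subset 4} (closed : Closed W) where

    ∗-cancelˡ-∈ : ∀ {a x} → a ∈ W → a ∗ x ∈ W → x ∈ W
    ∗-cancelˡ-∈ a∈W = left-translation-reflects (closed a∈W) refl

    ∗-cancelʳ-∈ : ∀ {a x} → a ∈ W → x ∗ a ∈ W → x ∈ W
    ∗-cancelʳ-∈ a∈W = right-translation-reflects (λ x∈W → closed x∈W a∈W) refl

    closed⇒subquasigroup : IsSubquasigroup Q W
    closed⇒subquasigroup =
      closed ,
      (λ a∈W b∈W → ∗-cancelˡ-∈ a∈W (subst (_∈ W) (sym (leftDividesˡ _ _)) b∈W)) ,
      (λ a∈W b∈W → ∗-cancelʳ-∈ a∈W (subst (_∈ W) (sym (rightDividesˡ _ _)) b∈W))

    ∈∗∉-∉ : ∀ {x z} → x ∈ W → z ∉ W → x ∗ z ∉ W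
    ∈∗∉-∉ x∈W z∉W = z∉W ∘ ∗-cancelˡ-∈ x∈W

    ∣W∣≤∣∁W∣ : ∀ {z} → z ∉ W → ∣ W ∣ ≤ ∣ ∁ W ∣
    ∣W∣≤∣∁W∣ z∉W = right-translation-∣∣≤ (λ x∈W → x∉p⇒x∈∁p (∈∗∉-∉ x∈W z∉W))

    ∉∗∉-∈ : ∣ W ∣ ≡ ∣ ∁ W ∣ → ∀ {x z} → x ∉ W → z ∉ W → x ∗ z ∈ W
    ∉∗∉-∈ ∣W∣≡∣∁W∣ x∉W z∉W = x∉∁p⇒x∈p
      (x∉W ∘ right-translation-reflects (λ y∈W → x∉p⇒x∈∁p (∈∗∉-∉ y∈W z∉W)) ∣W∣≡∣∁W∣)

    ∁-parity : ∣ W ∣ ≡ ∣ ∁ W ∣ → ∀ x y → not (lookup W (x ∗ y)) ≡ not (lookup W x) xor not (lookup W y)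
    ∁-parity ∣W∣≡∣∁W∣ x y with lookup W x in x∈W | lookup W y in y∈W
    ... | true  | true  = cong not ([]=⇒lookup (closed (lookup⇒[]= x W x∈W) (lookup⇒[]= y W y∈W)))
    ... | true  | false = cong not (∉⇒lookup≡false (∈∗∉-∉ (lookup⇒[]= x W x∈W) (lookup≡false⇒∉ y∈W)))
    ... | false | true  = cong not (∉⇒lookup≡false (lookup≡false⇒∉ x∈W ∘ ∗-cancelʳ-∈ (lookup⇒[]= y W y∈W)))
    ... | false | false = cong not ([]=⇒lookup (∉∗∉-∈ ∣W∣≡∣∁W∣ (lookup≡false⇒∉ x∈W) (lookup≡false⇒∉ y∈W)))

  module _ (h : Fin 4 → Bool) (h-∗ : ∀ x y → h (x ∗ y) ≡ h x xor h y) where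

    h-\\ : ∀ x y → h (x \\ y) ≡ h x xor h y
    h-\\ x y = begin
      h (x \\ y)                   ≡⟨ xor-cancelˡ (h x) (h (x \\ y)) ⟨
      h x xor (h x xor h (x \\ y)) ≡⟨ cong (h x xor_) (h-∗ x (x \\ y)) ⟨
      h x xor h (x ∗ (x \\ y))     ≡⟨ cong (λ z → h x xor h z) (leftDividesˡ x y) ⟩
      h x xor h y                  ∎

    h-// : ∀ x y → h (x // y) ≡ h x xor h y
    h-// x y = begin
      h (x // y)                   ≡⟨ xor-cancelʳ (h (x // y)) (h y) ⟨
      (h (x // y) xor h y) xor h y ≡⟨ cong (_xor h y) (h-∗ (x // y) y) ⟨
      h ((x // y) ∗ y) xor h y     ≡⟨ cong (λ z → h z xor h y) (rightDividesˡ y x) ⟩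
      h x xor h y                  ∎

    kernel-isCongruence : IsCongruence Q (λ x y → h x ≡ h y)
    kernel-isCongruence =
      record { refl = refl ; sym = sym ; trans = trans } ,
      compatible _∗_ h-∗ , compatible _\\_ h-\\ , compatible _//_ h-//
      where
      compatible : (_∘_ : Fin 4 → Fin 4 → Fin 4) → (∀ x y → h (x ∘ y) ≡ h x xor h y) →
                   ∀ {a b c d} → h a ≡ h b → h c ≡ h d → h (a ∘ c) ≡ h (b ∘ d)
      compatible _∘_ h-∘ {a} {b} {c} {d} ha≡hb hc≡hd =
        trans (h-∘ a c) (trans (cong₂ _xor_ ha≡hb hc≡hd) (sym (h-∘ b d)))

  ∁-closed : {W : Subset 4} → ∣ W ∣ ≡ ∣ ∁ W ∣ → (∀ {x y} → x ∈ W → y ∈ W → x ∗ y ∉ W) → Closed (∁ W)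
  ∁-closed {W} ∣W∣≡∣∁W∣ W∗W∩W≡∅ {c} {d} c∈∁W d∈∁W =
    x∉p⇒x∈∁p (x∈∁p⇒x∉p c∈∁W ∘ right-translation-reflects ∈∗∉-∈ refl)
    where
    ∈∗∉-∈ : ∀ {x} → x ∈ W → x ∗ d ∈ W
    ∈∗∉-∈ x∈W = x∉∁p⇒x∈p
      (x∈∁p⇒x∉p d∈∁W ∘ left-translation-reflects (x∉p⇒x∈∁p ∘ W∗W∩W≡∅ x∈W) ∣W∣≡∣∁W∣)

  subquasigroup⇒congruence :
    (Σ (Subset 4) λ W → IsSubquasigroup Q W × 1 < ∣ W ∣ × ∣ W ∣ < 4) →
    (Σ Fin4Rel λ θ → IsCongruence Q θ × Σ (Subset 4) λ W → IsClassOf Q θ W × ∣ W ∣ ≡ 2)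
  subquasigroup⇒congruence (W , (closed , _) , 1<∣W∣ , ∣W∣<4) =
    (λ x y → h x ≡ h y) , kernel-isCongruence h (∁-parity closed (∣p∣≡2⇒∣p∣≡∣∁p∣ {W} ∣W∣≡2)) , W ,
    (proj₁ a∈W , ∈⇔not-lookup≡ (proj₂ a∈W)) , ∣W∣≡2
    where
    h : Fin 4 → Bool
    h x = not (lookup W x)
    ∣W∣≡2 : ∣ W ∣ ≡ 2
    ∣W∣≡2 = 1<m≤4∸m⇒m≡2 1<∣W∣
      (subst (∣ W ∣ ≤_) (∣∁p∣≡n∸∣p∣ W) (∣W∣≤∣∁W∣ closed (proj₂ (∣p∣<n⇒∃∉ {p = W} ∣W∣<4))))
    a∈W : Nonempty W
    a∈W = ∣p∣>0⇒Nonempty {p = W} (subst (0 <_) (sym ∣W∣≡2) z<s)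

  module _ {θ : Fin4Rel} (θ-congruence : IsCongruence Q θ)
           {W : Subset 4} {a : Fin 4} (W≡[a] : ∀ x → x ∈ W ⇔ θ a x) where
    open IsEquivalence (proj₁ θ-congruence) renaming (sym to θ-sym; trans to θ-trans)

    private
      ∗-cong : ∀ {x y u v} → θ x y → θ u v → θ (x ∗ u) (y ∗ v)
      ∗-cong = proj₁ (proj₂ θ-congruence)
      to-class : ∀ {x} → x ∈ W → θ a x
      to-class = Equivalence.to (W≡[a] _)
      from-class : ∀ {x} → θ a x → x ∈ W
      from-class = Equivalence.from (W≡[a] _)

    idempotent-class-closed : a ∗ a ∈ W → Closed W
    idempotent-class-closed aa∈W x∈W y∈W =
      from-class (θ-trans (to-class aa∈W) (∗-cong (to-class x∈W) (to-class y∈W)))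

    class-∗-class-∉ : a ∗ a ∉ W → ∀ {x y} → x ∈ W → y ∈ W → x ∗ y ∉ W
    class-∗-class-∉ aa∉W x∈W y∈W xy∈W =
      aa∉W (from-class (θ-trans (to-class xy∈W) (θ-sym (∗-cong (to-class x∈W) (to-class y∈W)))))

  congruence⇒subquasigroup :
    (Σ Fin4Rel λ θ → IsCongruence Q θ × Σ (Subset 4) λ W → IsClassOf Q θ W × ∣ W ∣ ≡ 2) →
    (Σ (Subset 4) λ W → IsSubquasigroup Q W × 1 < ∣ W ∣ × ∣ W ∣ < 4)
  congruence⇒subquasigroup (θ , θ-congruence , W , (a , W≡[a]) , ∣W∣≡2) with a ∗ a ∈? W
  ... | yes aa∈W = W ,
    closed⇒subquasigroup (idempotent-class-closed θ-congruence W≡[a] aa∈W) , m≡2⇒1<m<4 ∣W∣≡2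
  ... | no aa∉W = ∁ W ,
    closed⇒subquasigroup (∁-closed (∣p∣≡2⇒∣p∣≡∣∁p∣ {W} ∣W∣≡2) (class-∗-class-∉ θ-congruence W≡[a] aa∉W)) ,
    m≡2⇒1<m<4 (∣p∣≡2⇒∣∁p∣≡2 {W} ∣W∣≡2)

proposition3 : (Q : Quasigroup4) →
    (Σ (Subset 4) λ W → IsSubquasigroup Q W × 1 < ∣ W ∣ × ∣ W ∣ < 4)
    ⇔
    (Σ (Fin4Rel) λ θ → IsCongruence Q θ × Σ (Subset 4) λ W → IsClassOf Q θ W × ∣ W ∣ ≡ 2)
proposition3 Q = mk⇔ (subquasigroup⇒congruence Q) (congruence⇒subquasigroup Q)
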